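{- Let $G$ be a connected simple graph with a fixed total order on its edges and let $T$ be an NBC spanning tree with $|\mathrm{IN}(T)|\ge 1$. Then there exists $e\in\mathrm{IN}(T)$ such that $\psi'_e(T)$ is an NBC spanning tree with $|\mathrm{IN}(\psi'_e(T))|=|\mathrm{IN}(T)|-1$. Moreover, $\psi_e(\psi'_e(T))=T$.
   Context: A broken circuit is the edge set of a cycle minus its smallest edge; an NBC spanning tree contains no broken circuit. For a spanning tree $T$ and $e\in E(T)$, $\mathrm{cut}(T,e)$ is the set of edges of $G$ joining the two components of $T-e$; $e$ is internally active if it is the minimum of $\mathrm{cut}(T,e)$ and internally inactive otherwise; $\mathrm{IA}(T)$ and $\mathrm{IN}(T)$ are the sets of internally active and inactive edges. For $f\notin E(T)$, $\mathrm{cyc}(T,f)$ is the edge set of the cycle in $T\cup f$. For $e\in\mathrm{IN}(T)$, $\psi'_e(T)=(T\cup\{\min\mathrm{cut}(T,e)\})\setminus\{e\}$. For a spanning tree $T'$ and $e\notin E(T')$, $\psi_e(T')=(T'\cup\{e\})\setminus\{\max(\mathrm{IA}(T')\cap\mathrm{cyc}(T',e))\}$. -}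

module Defs where

open import Data.Nat using (ℕ; zero; suc; _≤_)
open import Data.Fin using (Fin; zero; suc; _+_) renaming (_≤_ to _≤ᶠ_)
open import Data.Fin.Subset using (Subset; _∈_; _∉_; _∪_; _─_; ⁅_⁆)
open import Data.Product using (Σ; ∃; ∃-syntax; _×_; _,_; proj₁; proj₂)
open import Data.Nat.DivMod using (m%n<n)
open import Data.Sum using (_⊎_)
open import Data.List using (List; length)
open import Data.List.Relation.Unary.Unique.Propositional using (Unique)
import Data.List.Membership.Propositional as LM
open import Function.Definitions using (Injective)
open import Function.Bundles using (_⇔_)
open import Relation.Nullary using (¬_)
open import Relation.Binary.PropositionalEquality using (_≡_; _≢_)

next : ∀ {k} → Fin k → Fin k
next {suc k} i = Data.Fin.fromℕ< (m%n<n (suc (Data.Fin.toℕ i)) (suc k))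

-- A finite simple graph on vertex set Fin n whose edges are Fin m.
-- The fixed total order on edges is the order of their labels in Fin m.
record SimpleGraph : Set where
  field
    n : ℕ
    m : ℕ
    ends : Fin m → Fin n × Fin n
    loopless : ∀ e → proj₁ (ends e) ≢ proj₂ (ends e)
    noParallel : ∀ e e' →
      (ends e ≡ ends e' ⊎ ends e ≡ (proj₂ (ends e') , proj₁ (ends e'))) → e ≡ e'
open SimpleGraph public

module _ (G : SimpleGraph) where

  Joins : Fin (m G) → Fin (n G) → Fin (n G) → Set
  Joins e u v = ends G e ≡ (u , v) ⊎ ends G e ≡ (v , u)

  data Reach (S : Subset (m G)) (u : Fin (n G)) : Fin (n G) → Set where
    here : Reach S u u
    step : ∀ {v w} e → Reach S u v → e ∈ S → Joins e v w → Reach S u w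

  Connected : Set
  Connected = ∀ u v → Reach (Data.Fin.Subset.⊤) u v

  IsCycle : Subset (m G) → Set
  IsCycle C = Σ ℕ λ k → 3 ≤ k × Σ (Fin k → Fin (n G)) λ vs → Σ (Fin k → Fin (m G)) λ es →
    Injective _≡_ _≡_ vs × Injective _≡_ _≡_ es ×
    (∀ (i : Fin k) → Joins (es i) (vs i) (vs (next i))) ×
    (∀ e → e ∈ C ⇔ (∃[ i ] es i ≡ e))

  IsSpanningTree : Subset (m G) → Set
  IsSpanningTree T = (∀ u v → Reach T u v) ×
    (¬ Σ (Subset (m G)) λ C → IsCycle C × (∀ e → e ∈ C → e ∈ T))

  IsMin : (Fin (m G) → Set) → Fin (m G) → Set
  IsMin P e = P e × (∀ f → P f → e ≤ᶠ f)

  IsMax : (Fin (m G) → Set) → Fin (m G) → Set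
  IsMax P e = P e × (∀ f → P f → f ≤ᶠ e)

  -- T contains no broken circuit (C minus its smallest edge, C a cycle)
  IsNBC : Subset (m G) → Set
  IsNBC T = ¬ Σ (Subset (m G)) λ C → Σ (Fin (m G)) λ e →
    IsCycle C × IsMin (_∈ C) e × (∀ f → f ∈ C → f ≢ e → f ∈ T)

  -- cut(T,e): edges of G joining the two components of T - e
  -- (i.e. whose endpoints are not connected in T - e)
  Cut : Subset (m G) → Fin (m G) → Fin (m G) → Set
  Cut T e f = ¬ Reach (T ─ ⁅ e ⁆) (proj₁ (ends G f)) (proj₂ (ends G f))

  InternallyActive : Subset (m G) → Fin (m G) → Set
  InternallyActive T e = e ∈ T × IsMin (Cut T e) e

  InternallyInactive : Subset (m G) → Fin (m G) → Set
  InternallyInactive T e = e ∈ T × ¬ IsMin (Cut T e) e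

  Cyc : Subset (m G) → Fin (m G) → Fin (m G) → Set
  Cyc T f x = Σ (Subset (m G)) λ C → IsCycle C × (∀ y → y ∈ C → y ∈ T ⊎ y ≡ f) ×
    f ∈ C × x ∈ C

HasSize : ∀ {m} → (Fin m → Set) → ℕ → Set
HasSize {m} P k = Σ (List (Fin m)) λ xs → Unique xs × length xs ≡ k ×
  (∀ x → P x ⇔ x LM.∈ xs)

-- Let e be the least internally inactive edge of T and f the least edge of cut(T,e);
-- f ≠ e because e is inactive, and f ∉ T. Then T′ = T + f − e is a spanning tree with
-- T′ − f = T − e, so cut(T′,f) = cut(T,e) and f is internally active in T′.
-- For another edge x of T there are two cases. If the ends of f are linked in T − x,
-- then T − x and T′ − x have the same components and x has the same cut in both trees.
-- Otherwise f ∈ cut(T,x). Every edge of cut(T′,x) lies in cut(T,x) or in cut(T,e), so a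
-- T-active x, being at most f, is T′-active; conversely a T′-active x has e in its cut,
-- so x < e and x is T-active by the choice of e. Hence IN(T′) = IN(T) − e. A broken circuit of T′ must use f, and its least edge c
-- then lies in cut(T,e), forcing c = f. Finally every T′-active edge on the cycle of e
-- in T′ + e lies below e, hence is T-active with f in its cut, so it is at most f.
module Submission where

open import Defs
open import Data.Bool using (true)
open import Data.Empty using (⊥; ⊥-elim)
open import Data.Fin as Fin using (Fin; zero; suc; toℕ; fromℕ; inject₁) renaming (_≤_ to _≤ᶠ_)
import Data.Fin.Properties as Fin
open import Data.Fin.Relation.Unary.Top using (view; ‵fromℕ; ‵inject₁)
open import Data.Fin.Subset using (Subset; _∈_; _∉_; _⊆_; _∪_; _─_; _-_; ⁅_⁆; inside; outside)
open import Data.Fin.Subset.Properties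
  using (_∈?_; x∈p∪q⁺; x∈p∪q⁻; x∈⁅x⁆; x∈⁅y⁆⇒x≡y; x≢y⇒x∉⁅y⁆; x∉⁅y⁆⇒x≢y; ⊆-antisym; p─q─r≡p─r─q)
open import Data.List using (List; []; _∷_; length; filter; allFin)
open import Data.List.Membership.Propositional using () renaming (_∈_ to _∈ˡ_)
open import Data.List.Membership.Propositional.Properties using (∈-filter⁺; ∈-filter⁻; ∈-allFin)
import Data.List.Membership.DecPropositional as DecMembership
open import Data.List.Properties using (filter-reject; filter-all)
import Data.List.Relation.Unary.All as All
open import Data.List.Relation.Unary.AllPairs using (_∷_)
open import Data.List.Relation.Unary.Any using (here; there)
open import Data.List.Relation.Unary.Unique.Propositional using (Unique)
import Data.List.Relation.Unary.Unique.Propositional.Properties as Unique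
open import Data.Nat as ℕ using (ℕ; zero; suc; z≤n; s≤s; _≤′_; ≤′-refl; ≤′-step)
import Data.Nat.Properties as ℕ
open import Data.Nat.DivMod using (_mod_; n%n≡0; m<n⇒m%n≡m)
open import Data.Product using (Σ; ∃; _×_; _,_; proj₁; proj₂)
import Data.Product as Product
open import Data.Sum using (_⊎_; inj₁; inj₂; [_,_]′)
import Data.Sum as Sum
open import Data.Vec using (_∷_; here; there; lookup; tabulate)
open import Data.Vec.Properties using (lookup∘tabulate; lookup⇒[]=; []=⇒lookup)
open import Function using (_∘_)
open import Function.Bundles using (_⇔_; mk⇔; Equivalence)
open import Function.Definitions using (Injective)
open import Relation.Nullary using (¬_; Dec; yes; no; does; ¬?)
open import Relation.Nullary.Decidable using (_×-dec_; _⊎-dec_; decidable-stable)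
import Relation.Nullary.Decidable as Dec
open import Relation.Binary.PropositionalEquality using (_≡_; _≢_; refl; sym; trans; cong; subst; subst₂)

open Equivalence using (to; from)

x∈p─q⁺ : ∀ {n} {x : Fin n} {p q : Subset n} → x ∈ p → x ∉ q → x ∈ p ─ q
x∈p─q⁺ {q = inside  ∷ _} here        x∉q = ⊥-elim (x∉q here)
x∈p─q⁺ {q = outside ∷ _} here        _   = here
x∈p─q⁺ {q = _       ∷ _} (there x∈p) x∉q = there (x∈p─q⁺ x∈p (x∉q ∘ there))

x∈p─q⁻ : ∀ {n} {x : Fin n} (p q : Subset n) → x ∈ p ─ q → x ∈ p × x ∉ q
x∈p─q⁻ (inside  ∷ _) (outside ∷ _) here = here , λ ()
x∈p─q⁻ {x = zero} (inside  ∷ _) (inside  ∷ _) ()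
x∈p─q⁻ {x = zero} (outside ∷ _) (inside  ∷ _) ()
x∈p─q⁻ {x = zero} (outside ∷ _) (outside ∷ _) ()
x∈p─q⁻ (_ ∷ p) (_ ∷ q) (there x∈p─q) =
  Product.map there (λ x∉q → λ { (there x∈q) → x∉q x∈q }) (x∈p─q⁻ p q x∈p─q)

x∈p-y⁺ : ∀ {n} {x y : Fin n} {p : Subset n} → x ∈ p → x ≢ y → x ∈ p - y
x∈p-y⁺ x∈p x≢y = x∈p─q⁺ x∈p (x≢y⇒x∉⁅y⁆ x≢y)

x∈p-y⁻ : ∀ {n} {x y : Fin n} {p : Subset n} → x ∈ p - y → x ∈ p × x ≢ y
x∈p-y⁻ {y = y} {p} x∈p-y = Product.map₂ x∉⁅y⁆⇒x≢y (x∈p─q⁻ p ⁅ y ⁆ x∈p-y)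

p-y⊆p : ∀ {n} {y : Fin n} {p : Subset n} → p - y ⊆ p
p-y⊆p = proj₁ ∘ x∈p-y⁻

-y-mono : ∀ {n} {y : Fin n} {p q : Subset n} → p ⊆ q → p - y ⊆ q - y
-y-mono p⊆q x∈p-y = Product.uncurry (x∈p-y⁺ ∘ p⊆q) (x∈p-y⁻ x∈p-y)

-swap : ∀ {n} {x y : Fin n} {p : Subset n} → (p - x) - y ⊆ (p - y) - x
-swap {x = x} {y} {p} = subst (_ ∈_) (p─q─r≡p─r─q p ⁅ x ⁆ ⁅ y ⁆)

x∈p∪⁅y⁆⁺ : ∀ {n} {x y : Fin n} {p : Subset n} → x ∈ p ⊎ x ≡ y → x ∈ p ∪ ⁅ y ⁆
x∈p∪⁅y⁆⁺ (inj₁ x∈p)  = x∈p∪q⁺ (inj₁ x∈p)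
x∈p∪⁅y⁆⁺ (inj₂ refl) = x∈p∪q⁺ (inj₂ (x∈⁅x⁆ _))

x∈p∪⁅y⁆⁻ : ∀ {n} {x y : Fin n} {p : Subset n} → x ∈ p ∪ ⁅ y ⁆ → x ∈ p ⊎ x ≡ y
x∈p∪⁅y⁆⁻ {y = y} {p} = Sum.map₂ (x∈⁅y⁆⇒x≡y y) ∘ x∈p∪q⁻ p ⁅ y ⁆

≡-pair : ∀ {A B : Set} {a c : A} {b d : B} → (a , b) ≡ (c , d) → a ≡ c × b ≡ d
≡-pair refl = refl , refl

x∈p⊎x≡y : ∀ {n} {x : Fin n} {p : Subset n} y → x ∈ p → x ∈ p - y ⊎ x ≡ y
x∈p⊎x≡y {x = x} y x∈p with x Fin.≟ y
... | yes x≡y = inj₂ x≡y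
... | no  x≢y = inj₁ (x∈p-y⁺ x∈p x≢y)

subset : ∀ {n} {P : Fin n → Set} → (∀ x → Dec (P x)) → Subset n
subset P? = tabulate (does ∘ P?)

∈-subset : ∀ {n} {P : Fin n → Set} (P? : ∀ x → Dec (P x)) {x} → x ∈ subset P? ⇔ P x
∈-subset P? {x} = mk⇔
  (λ x∈ → sound (P? x) (trans (sym (lookup∘tabulate _ x)) ([]=⇒lookup x∈)))
  (λ px → lookup⇒[]= x _ (trans (lookup∘tabulate _ x) (Dec.dec-true (P? x) px)))
  where
  sound : ∀ {A : Set} (a? : Dec A) → does a? ≡ true → A
  sound (yes a) _ = a
  sound (no _) ()

least : ∀ {n} {P : Fin n → Set} → (∀ x → Dec (P x)) → Σ (Fin n) P →
        Σ (Fin n) λ x → P x × (∀ y → P y → x ≤ᶠ y)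
least {suc n} {P} P? (x , px) with P? zero | x
... | yes p₀ | _     = zero , p₀ , λ _ _ → z≤n
... | no ¬p₀ | zero  = ⊥-elim (¬p₀ px)
... | no ¬p₀ | suc x with least (P? ∘ suc) (x , px)
...   | y , py , y-least = suc y , py , bound
  where
  bound : ∀ z → P z → suc y ≤ᶠ z
  bound zero    pz = ⊥-elim (¬p₀ pz)
  bound (suc z) pz = s≤s (y-least z pz)

snoc : ∀ {A : Set} {n} → (Fin n → A) → A → Fin (suc n) → A
snoc {n = zero}  f a _       = a
snoc {n = suc n} f a zero    = f zero
snoc {n = suc n} f a (suc i) = snoc (f ∘ suc) a i

snoc-fromℕ : ∀ {A : Set} {n} (f : Fin n → A) a → snoc f a (fromℕ n) ≡ a
snoc-fromℕ {n = zero}  f a = refl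
snoc-fromℕ {n = suc n} f a = snoc-fromℕ (f ∘ suc) a

snoc-inject₁ : ∀ {A : Set} {n} (f : Fin n → A) a i → snoc f a (inject₁ i) ≡ f i
snoc-inject₁ f a zero    = refl
snoc-inject₁ f a (suc i) = snoc-inject₁ (f ∘ suc) a i

toℕ-mod : ∀ {t n} .{{_ : ℕ.NonZero n}} → t ℕ.< n → toℕ (t mod n) ≡ t
toℕ-mod t<n = trans (Fin.toℕ-fromℕ< _) (m<n⇒m%n≡m t<n)

mod-toℕ : ∀ {n} (i : Fin (suc n)) → toℕ i mod suc n ≡ i
mod-toℕ i = Fin.toℕ-injective (toℕ-mod (Fin.toℕ<n i))

mod-self : ∀ n → suc n mod suc n ≡ zero
mod-self n = Fin.fromℕ<-cong _ 0 (n%n≡0 (suc n)) _ (s≤s z≤n)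

next-mod : ∀ {n t} → t ℕ.< suc n → next (t mod suc n) ≡ suc t mod suc n
next-mod {n} t<n = cong (λ s → suc s mod suc n) (toℕ-mod t<n)

next-inject₁ : ∀ {n} (i : Fin n) → next (inject₁ i) ≡ suc i
next-inject₁ {n} i = Fin.toℕ-injective
  (trans (toℕ-mod {t = suc (toℕ (inject₁ i))} (s≤s i<n)) (cong suc (Fin.toℕ-inject₁ i)))
  where
  i<n : toℕ (inject₁ i) ℕ.< n
  i<n = subst (ℕ._< n) (sym (Fin.toℕ-inject₁ i)) (Fin.toℕ<n i)

next-fromℕ : ∀ n → next (fromℕ n) ≡ zero
next-fromℕ n = trans (cong (λ s → suc s mod suc n) (Fin.toℕ-fromℕ n)) (mod-self n)

module _ {n : ℕ} {x : Fin n} where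

  ≢? : ∀ y → Dec (y ≢ x)
  ≢? y = ¬? (y Fin.≟ x)

  length-filter-≢ : ∀ {xs} → Unique xs → x ∈ˡ xs → suc (length (filter ≢? xs)) ≡ length xs
  length-filter-≢ {_ ∷ xs} (x∉xs ∷ _) (here refl)
    rewrite filter-reject ≢? {x} {xs} (λ x≢x → x≢x refl)
          | filter-all ≢? {xs} (All.map (_∘ sym) x∉xs) = refl
  length-filter-≢ {y ∷ xs} (y∉xs ∷ xs!) (there x∈xs) with y Fin.≟ x
  ... | yes refl = ⊥-elim (All.lookup y∉xs x∈xs refl)
  ... | no  _    = cong suc (length-filter-≢ xs! x∈xs)

module _ {n : ℕ} {P : Fin n → Set} where

  HasSize⇒Decidable : ∀ {k} → HasSize P k → ∀ x → Dec (P x)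
  HasSize⇒Decidable (xs , _ , _ , P⇔) x =
    Dec.map (mk⇔ (from (P⇔ x)) (to (P⇔ x))) (DecMembership._∈?_ Fin._≟_ x xs)

  HasSize-suc⇒nonempty : ∀ {k} → HasSize P (suc k) → Σ (Fin n) P
  HasSize-suc⇒nonempty (x ∷ _ , _ , _ , P⇔) = x , from (P⇔ x) (here refl)

  HasSize-remove : ∀ {k x} {Q : Fin n → Set} → HasSize P (suc k) → P x →
                   (∀ y → Q y ⇔ (P y × y ≢ x)) → HasSize Q k
  HasSize-remove {k} {x} {Q} (xs , xs! , |xs| , P⇔) px Q⇔ =
    filter ≢? xs , Unique.filter⁺ ≢? xs! ,
    ℕ.suc-injective (trans (length-filter-≢ xs! (to (P⇔ x) px)) |xs|) , Q⇔′
    where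
    Q⇔′ : ∀ y → Q y ⇔ y ∈ˡ filter ≢? xs
    Q⇔′ y = mk⇔
      (λ qy → let (py , y≢x) = to (Q⇔ y) qy in ∈-filter⁺ ≢? (to (P⇔ y) py) y≢x)
      (λ y∈ → let (y∈xs , y≢x) = ∈-filter⁻ ≢? y∈ in from (Q⇔ y) (from (P⇔ y) y∈xs , y≢x))

module Properties (G : SimpleGraph) where

  V : Set
  V = Fin (n G)

  E : Set
  E = Fin (m G)

  src tgt : E → V
  src z = proj₁ (ends G z)
  tgt z = proj₂ (ends G z)

  Linked : Subset (m G) → E → Set
  Linked S z = Reach G S (src z) (tgt z)

  Acyclic : Subset (m G) → Set
  Acyclic S = ¬ Σ (Subset (m G)) λ C → IsCycle G C × (∀ z → z ∈ C → z ∈ S)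

  CycleThrough : Subset (m G) → E → Set
  CycleThrough S y = Σ (Subset (m G)) λ C → IsCycle G C × (∀ z → z ∈ C → z ∈ S ⊎ z ≡ y) × y ∈ C

  -- Edges and reachability

  Joins-sym : ∀ {z u v} → Joins G z u v → Joins G z v u
  Joins-sym = Sum.swap

  Joins-unique : ∀ {z u v u′ v′} → Joins G z u v → Joins G z u′ v′ →
                 (u ≡ u′ × v ≡ v′) ⊎ (u ≡ v′ × v ≡ u′)
  Joins-unique (inj₁ p) (inj₁ q) = inj₁ (≡-pair (trans (sym p) q))
  Joins-unique (inj₁ p) (inj₂ q) = inj₂ (≡-pair (trans (sym p) q))
  Joins-unique (inj₂ p) (inj₁ q) = inj₂ (Product.swap (≡-pair (trans (sym p) q)))
  Joins-unique (inj₂ p) (inj₂ q) = inj₁ (Product.swap (≡-pair (trans (sym p) q)))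

  module _ {S : Subset (m G)} where

    reach-trans : ∀ {u v w} → Reach G S u v → Reach G S v w → Reach G S u w
    reach-trans r here              = r
    reach-trans r (step z r′ z∈S J) = step z (reach-trans r r′) z∈S J

    reach-sym : ∀ {u v} → Reach G S u v → Reach G S v u
    reach-sym here             = here
    reach-sym (step z r z∈S J) = reach-trans (step z here z∈S (Joins-sym J)) (reach-sym r)

    edge-linked : ∀ {z} → z ∈ S → Linked S z
    edge-linked z∈S = step _ here z∈S (inj₁ refl)

    linked⇒reach : ∀ {z u v} → Linked S z → Joins G z u v → Reach G S u v
    linked⇒reach r (inj₁ refl) = r
    linked⇒reach r (inj₂ refl) = reach-sym r

    reach⇒linked : ∀ {z u v} → Joins G z u v → Reach G S u v → Linked S z
    reach⇒linked (inj₁ refl) r = r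
    reach⇒linked (inj₂ refl) r = reach-sym r

    reach-chain : (w : ℕ → V) {a b : ℕ} → a ≤′ b →
                  (∀ t → a ℕ.≤ t → t ℕ.< b → Reach G S (w t) (w (suc t))) → Reach G S (w a) (w b)
    reach-chain w ≤′-refl         _    = here
    reach-chain w (≤′-step a≤′b) link =
      reach-trans (reach-chain w a≤′b λ t a≤t t<b → link t a≤t (ℕ.m<n⇒m<1+n t<b))
                  (link _ (ℕ.≤′⇒≤ a≤′b) (ℕ.n<1+n _))

  reach-mono : ∀ {S R u v} → S ⊆ R → Reach G S u v → Reach G R u v
  reach-mono S⊆R here             = here
  reach-mono S⊆R (step z r z∈S J) = step z (reach-mono S⊆R r) (S⊆R z∈S) J

  reach-reroute : ∀ {S R u v} → (∀ {z} → z ∈ S → z ∈ R ⊎ Linked R z) → Reach G S u v → Reach G R u v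
  reach-reroute via here = here
  reach-reroute via (step z r z∈S J) with via z∈S
  ... | inj₁ z∈R   = step z (reach-reroute via r) z∈R J
  ... | inj₂ z-lnk = reach-trans (reach-reroute via r) (linked⇒reach z-lnk J)

  Split : Subset (m G) → E → V → V → Set
  Split R y u v = Reach G R u v ⊎ (Reach G R u (src y) × Reach G R (tgt y) v)
                               ⊎ (Reach G R u (tgt y) × Reach G R (src y) v)

  split-extend : ∀ {R y u v w} → Split R y u v → Joins G y v w → Split R y u w
  split-extend (inj₁ r)                 (inj₁ refl) = inj₂ (inj₁ (r , here))
  split-extend (inj₁ r)                 (inj₂ refl) = inj₂ (inj₂ (r , here))
  split-extend (inj₂ (inj₁ (r , _)))    (inj₁ refl) = inj₂ (inj₁ (r , here))
  split-extend (inj₂ (inj₁ (r , _)))    (inj₂ refl) = inj₁ r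
  split-extend (inj₂ (inj₂ (r , _)))    (inj₁ refl) = inj₁ r
  split-extend (inj₂ (inj₂ (r , _)))    (inj₂ refl) = inj₂ (inj₂ (r , here))

  reach-split : ∀ {S u v} y → Reach G S u v → Split (S - y) y u v
  reach-split y here = inj₁ here
  reach-split y (step z r z∈S J) with x∈p⊎x≡y y z∈S | reach-split y r
  ... | inj₂ refl | r-split                 = split-extend r-split J
  ... | inj₁ z∈R  | inj₁ r′                 = inj₁ (step z r′ z∈R J)
  ... | inj₁ z∈R  | inj₂ (inj₁ (r₁ , r₂)) = inj₂ (inj₁ (r₁ , step z r₂ z∈R J))
  ... | inj₁ z∈R  | inj₂ (inj₂ (r₁ , r₂)) = inj₂ (inj₂ (r₁ , step z r₂ z∈R J))

  split-join : ∀ {S y u v} → y ∈ S → Split (S - y) y u v → Reach G S u v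
  split-join y∈S (inj₁ r) = reach-mono p-y⊆p r
  split-join y∈S (inj₂ (inj₁ (r₁ , r₂))) =
    reach-trans (reach-mono p-y⊆p r₁) (reach-trans (edge-linked y∈S) (reach-mono p-y⊆p r₂))
  split-join y∈S (inj₂ (inj₂ (r₁ , r₂))) =
    reach-trans (reach-mono p-y⊆p r₁) (reach-trans (reach-sym (edge-linked y∈S)) (reach-mono p-y⊆p r₂))

  -- Every link of z's ends in S runs through y, so y's ends are linked through z.
  reach-exchange : ∀ {S R y z} → S - y ⊆ R → z ∈ R → Linked S z → ¬ Linked (S - y) z → Linked R y
  reach-exchange {y = y} S-y⊆R z∈R r ¬r with reach-split y r
  ... | inj₁ r′ = ⊥-elim (¬r r′)
  ... | inj₂ (inj₁ (r₁ , r₂)) = reach-trans (reach-mono S-y⊆R (reach-sym r₁))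
                                 (reach-trans (edge-linked z∈R) (reach-mono S-y⊆R (reach-sym r₂)))
  ... | inj₂ (inj₂ (r₁ , r₂)) = reach-trans (reach-mono S-y⊆R r₂)
                                 (reach-trans (reach-sym (edge-linked z∈R)) (reach-mono S-y⊆R r₁))

  reach-avoiding : ∀ {S T y u v} → Cut G T y y → S ⊆ T →
                   Reach G S u v → Reach G (T - y) u v → Reach G (S - y) u v
  reach-avoiding {S} {T} {y} {u} {v} y∈cut S⊆T r r′ = avoid (reach-split y r)
    where
    lift : ∀ {a b} → Reach G (S - y) a b → Reach G (T - y) a b
    lift = reach-mono (-y-mono S⊆T)
    avoid : Split (S - y) y u v → Reach G (S - y) u v
    avoid (inj₁ r-y) = r-y
    avoid (inj₂ (inj₁ (r₁ , r₂))) =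
      ⊥-elim (y∈cut (reach-trans (reach-sym (lift r₁)) (reach-trans r′ (reach-sym (lift r₂)))))
    avoid (inj₂ (inj₂ (r₁ , r₂))) =
      ⊥-elim (y∈cut (reach-trans (lift r₂) (reach-trans (reach-sym r′) (lift r₁))))

  private
    reach?-within : ∀ (zs : List E) {S} → (∀ {z} → z ∈ S → z ∈ˡ zs) → ∀ u v → Dec (Reach G S u v)
    reach?-within [] {S} S⊆[] u v = Dec.map (mk⇔ (λ { refl → here }) trivial) (u Fin.≟ v)
      where
      trivial : ∀ {u v} → Reach G S u v → u ≡ v
      trivial here = refl
      trivial (step _ _ z∈S _) with S⊆[] z∈S
      ... | ()
    reach?-within (y ∷ zs) {S} S⊆y∷zs u v = by-cases (y ∈? S)
      where
      S-y⊆zs : ∀ {z} → z ∈ S - y → z ∈ˡ zs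
      S-y⊆zs z∈S-y with x∈p-y⁻ z∈S-y
      ... | z∈S , z≢y with S⊆y∷zs z∈S
      ...   | here z≡y   = ⊥-elim (z≢y z≡y)
      ...   | there z∈zs = z∈zs
      rec : ∀ u v → Dec (Reach G (S - y) u v)
      rec = reach?-within zs S-y⊆zs
      by-cases : Dec (y ∈ S) → Dec (Reach G S u v)
      by-cases (yes y∈S) = Dec.map (mk⇔ (split-join y∈S) (reach-split y))
        (rec u v ⊎-dec ((rec u (src y) ×-dec rec (tgt y) v) ⊎-dec (rec u (tgt y) ×-dec rec (src y) v)))
      by-cases (no y∉S) = Dec.map (mk⇔ (reach-mono p-y⊆p) (reach-mono S⊆S-y)) (rec u v)
        where
        S⊆S-y : S ⊆ S - y
        S⊆S-y z∈S = x∈p-y⁺ z∈S λ { refl → y∉S z∈S }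

  reach? : ∀ S u v → Dec (Reach G S u v)
  reach? S = reach?-within (allFin (m G)) (λ {z} _ → ∈-allFin z)

  cut? : ∀ T e z → Dec (Cut G T e z)
  cut? T e z = ¬? (reach? (T - e) (src z) (tgt z))

  -- Cycles

  around : ∀ {S k} (vs : Fin (suc k) → V) j →
           (∀ i → i ≢ j → Reach G S (vs i) (vs (next i))) → Reach G S (vs (next j)) (vs j)
  around {S} {k} vs j link =
    reach-trans (subst (Reach G S _) (cong vs (mod-self k)) upper)
                (subst (Reach G S _) (cong vs (mod-toℕ j)) lower)
    where
    w : ℕ → V
    w t = vs (t mod suc k)
    link-mod : ∀ t → t ℕ.< suc k → t ≢ toℕ j → Reach G S (w t) (w (suc t))
    link-mod t t<n t≢j = subst (Reach G S (w t) ∘ vs) (next-mod t<n)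
      (link (t mod suc k) λ t≡j → t≢j (trans (sym (toℕ-mod t<n)) (cong toℕ t≡j)))
    upper : Reach G S (w (suc (toℕ j))) (w (suc k))
    upper = reach-chain w (ℕ.≤⇒≤′ (Fin.toℕ<n j))
      λ t j<t t<n → link-mod t t<n λ t≡j → ℕ.<-irrefl (sym t≡j) j<t
    lower : Reach G S (w 0) (w (toℕ j))
    lower = reach-chain w (ℕ.≤⇒≤′ z≤n)
      λ t _ t<j → link-mod t (ℕ.<-trans t<j (Fin.toℕ<n j)) (ℕ.<⇒≢ t<j)

  cycle-closes : ∀ {S C x} → IsCycle G C → x ∈ C →
                 (∀ {z} → z ∈ C → z ≢ x → Linked S z) → Linked S x
  cycle-closes (zero , () , _)
  cycle-closes {S} (suc k , _ , vs , es , _ , es-inj , joins , C⇔) x∈C others with to (C⇔ _) x∈C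
  ... | j , refl = reach⇒linked (joins j) (reach-sym (around vs j link))
    where
    link : ∀ i → i ≢ j → Reach G S (vs i) (vs (next i))
    link i i≢j = linked⇒reach (others (from (C⇔ _) (i , refl)) (i≢j ∘ es-inj)) (joins i)

  record SimplePath (S : Subset (m G)) (ℓ : ℕ) (u v : V) : Set where
    field
      vertex : Fin (suc ℓ) → V
      edge   : Fin ℓ → E
      first  : vertex zero ≡ u
      last   : vertex (fromℕ ℓ) ≡ v
      joins  : ∀ i → Joins G (edge i) (vertex (inject₁ i)) (vertex (suc i))
      in-S   : ∀ i → edge i ∈ S
      simple : Injective _≡_ _≡_ vertex
  open SimplePath

  trivial-path : ∀ {S u} → SimplePath S 0 u u
  trivial-path {u = u} = record
    { vertex = λ _ → u ; edge = λ () ; first = refl ; last = refl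
    ; joins = λ () ; in-S = λ () ; simple = λ { {zero} {zero} _ → refl } }

  path-cons : ∀ {S ℓ u v w z} (P : SimplePath S ℓ u v) → z ∈ S → Joins G z u w →
              (∀ i → vertex P i ≢ w) → SimplePath S (suc ℓ) w v
  path-cons {S} {ℓ} {w = w} {z} P z∈S J fresh = record
    { vertex = vertex′ ; edge = edge′ ; first = refl ; last = last P
    ; joins = joins′ ; in-S = in-S′ ; simple = simple′ }
    where
    vertex′ : Fin (suc (suc ℓ)) → V
    vertex′ zero    = w
    vertex′ (suc i) = vertex P i
    edge′ : Fin (suc ℓ) → E
    edge′ zero    = z
    edge′ (suc i) = edge P i
    joins′ : ∀ i → Joins G (edge′ i) (vertex′ (inject₁ i)) (vertex′ (suc i))
    joins′ zero    = subst (Joins G z w) (sym (first P)) (Joins-sym J)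
    joins′ (suc i) = joins P i
    in-S′ : ∀ i → edge′ i ∈ S
    in-S′ zero    = z∈S
    in-S′ (suc i) = in-S P i
    simple′ : Injective _≡_ _≡_ vertex′
    simple′ {zero}  {zero}  _  = refl
    simple′ {zero}  {suc j} eq = ⊥-elim (fresh j (sym eq))
    simple′ {suc i} {zero}  eq = ⊥-elim (fresh i eq)
    simple′ {suc i} {suc j} eq = cong suc (simple P eq)

  path-tail : ∀ {S ℓ u v} (P : SimplePath S (suc ℓ) u v) → SimplePath S ℓ (vertex P (suc zero)) v
  path-tail P = record
    { vertex = vertex P ∘ suc ; edge = edge P ∘ suc ; first = refl ; last = last P
    ; joins = joins P ∘ suc ; in-S = in-S P ∘ suc ; simple = Fin.suc-injective ∘ simple P }

  path-drop : ∀ {S ℓ u v} (P : SimplePath S ℓ u v) j → ∃ λ ℓ′ → SimplePath S ℓ′ (vertex P j) v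
  path-drop P zero = _ , record
    { vertex = vertex P ; edge = edge P ; first = refl ; last = last P
    ; joins = joins P ; in-S = in-S P ; simple = simple P }
  path-drop {ℓ = suc ℓ} P (suc j) = path-drop (path-tail P) j

  simple-path : ∀ {S u v} → Reach G S v u → ∃ λ ℓ → SimplePath S ℓ u v
  simple-path here = 0 , trivial-path
  simple-path {S} {v = v} (step {w = w} z r z∈S J) with simple-path r
  ... | ℓ , P with Fin.any? (λ i → vertex P i Fin.≟ w)
  ...   | yes (j , vⱼ≡w) = subst (λ x → ∃ λ ℓ → SimplePath S ℓ x v) vⱼ≡w (path-drop P j)
  ...   | no  fresh      = suc ℓ , path-cons P z∈S J λ i vᵢ≡w → fresh (i , vᵢ≡w)

  inject₁≡suc⇒> : ∀ {k} {i j : Fin k} → inject₁ i ≡ suc j → toℕ j ℕ.< toℕ i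
  inject₁≡suc⇒> {i = i} eq = ℕ.≤-reflexive (sym (trans (sym (Fin.toℕ-inject₁ i)) (cong toℕ eq)))

  -- The closing edge y goes last: the cycle visits the path and returns along y.
  path-closes : ∀ {S ℓ y} → y ∉ S → SimplePath S ℓ (tgt y) (src y) → CycleThrough S y
  path-closes {ℓ = zero} {y} _ P = ⊥-elim (loopless G y (trans (sym (last P)) (first P)))
  path-closes {ℓ = suc zero} {y} y∉S P =
    ⊥-elim (y∉S (subst (_∈ _) (noParallel G (edge P zero) y J) (in-S P zero)))
    where
    J : Joins G (edge P zero) (src y) (tgt y)
    J = Joins-sym (subst₂ (Joins G (edge P zero)) (first P) (last P) (joins P zero))
  path-closes {S} {ℓ@(suc (suc _))} {y} y∉S P =
    C , (suc ℓ , s≤s (s≤s (s≤s z≤n)) , vertex P , es , simple P , es-inj , es-joins , λ _ → ∈-subset es?) ,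
    C⊆S∪y , from (∈-subset es?) (fromℕ ℓ , es-last)
    where
    es : Fin (suc ℓ) → E
    es = snoc (edge P) y
    es? : ∀ z → Dec (∃ λ i → es i ≡ z)
    es? z = Fin.any? λ i → es i Fin.≟ z
    C : Subset (m G)
    C = subset es?
    edge-inj : Injective _≡_ _≡_ (edge P)
    edge-inj {a} {b} eq with Joins-unique (joins P a) (subst (λ z → Joins G z _ _) (sym eq) (joins P b))
    ... | inj₁ (p , _) = Fin.inject₁-injective (simple P p)
    ... | inj₂ (p , q) = ⊥-elim (ℕ.<-asym (inject₁≡suc⇒> (simple P p)) (inject₁≡suc⇒> (simple P (sym q))))
    es-last : es (fromℕ ℓ) ≡ y
    es-last = snoc-fromℕ (edge P) y
    es-path : ∀ j → es (inject₁ j) ≡ edge P j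
    es-path = snoc-inject₁ (edge P) y
    path-edge≢y : ∀ j → edge P j ≢ y
    path-edge≢y j eq = y∉S (subst (_∈ S) eq (in-S P j))
    es-inj : Injective _≡_ _≡_ es
    es-inj {i} {j} eq with view i | view j
    ... | ‵fromℕ     | ‵fromℕ     = refl
    ... | ‵fromℕ     | ‵inject₁ b = ⊥-elim (path-edge≢y b (trans (sym (es-path b)) (trans (sym eq) es-last)))
    ... | ‵inject₁ a | ‵fromℕ     = ⊥-elim (path-edge≢y a (trans (sym (es-path a)) (trans eq es-last)))
    ... | ‵inject₁ a | ‵inject₁ b = cong inject₁ (edge-inj (trans (sym (es-path a)) (trans eq (es-path b))))
    es-joins : ∀ i → Joins G (es i) (vertex P i) (vertex P (next i))
    es-joins i with view i
    ... | ‵fromℕ     rewrite es-last   | next-fromℕ ℓ   | last P | first P = inj₁ refl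
    ... | ‵inject₁ j rewrite es-path j | next-inject₁ j = joins P j
    C⊆S∪y : ∀ z → z ∈ C → z ∈ S ⊎ z ≡ y
    C⊆S∪y z z∈C with to (∈-subset es?) z∈C
    ... | i , refl with view i
    ...   | ‵fromℕ     = inj₂ es-last
    ...   | ‵inject₁ j = inj₁ (subst (_∈ S) (sym (es-path j)) (in-S P j))

  cycle-through : ∀ {S y} → y ∉ S → Linked S y → CycleThrough S y
  cycle-through y∉S r = path-closes y∉S (proj₂ (simple-path r))

  -- Spanning trees

  tree-edge-cut : ∀ {T x} → Acyclic T → x ∈ T → Cut G T x x
  tree-edge-cut {T} {x} acyclic x∈T r with cycle-through (λ x∈T-x → proj₂ (x∈p-y⁻ x∈T-x) refl) r
  ... | C , cycle , C⊆ , _ = acyclic (C , cycle , λ z z∈C → [ p-y⊆p , (λ { refl → x∈T }) ]′ (C⊆ z z∈C))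

  cycle-edge-cut : ∀ {S C x y} → Acyclic S → IsCycle G C → (∀ z → z ∈ C → z ∈ S ⊎ z ≡ y) →
                   x ∈ C → x ∈ S → x ≢ y → Cut G S x y
  cycle-edge-cut {S} {C} {x} acyclic cycle C⊆S∪y x∈C x∈S x≢y y-linked =
    tree-edge-cut acyclic x∈S (cycle-closes cycle x∈C others)
    where
    others : ∀ {z} → z ∈ C → z ≢ x → Linked (S - x) z
    others {z} z∈C z≢x with C⊆S∪y z z∈C
    ... | inj₁ z∈S  = edge-linked (x∈p-y⁺ z∈S z≢x)
    ... | inj₂ refl = y-linked

  ¬inactive⇒active : ∀ {T x} → Acyclic T → x ∈ T → ¬ InternallyInactive G T x → IsMin G (Cut G T x) x
  ¬inactive⇒active acyclic x∈T ¬inactive = tree-edge-cut acyclic x∈T , λ y y∈cut →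
    decidable-stable (_ Fin.≤? y) λ x≰y → ¬inactive (x∈T , λ x-min → x≰y (proj₂ x-min y y∈cut))

  below-least-inactive : ∀ {T e x} → Acyclic T → (∀ y → InternallyInactive G T y → e ≤ᶠ y) →
                         x ∈ T → x ≤ᶠ e → x ≢ e → IsMin G (Cut G T x) x
  below-least-inactive acyclic e-least x∈T x≤e x≢e = ¬inactive⇒active acyclic x∈T
    λ x-inactive → x≢e (Fin.≤-antisym x≤e (e-least _ x-inactive))

  IsMin-cong : ∀ {P Q : E → Set} {x} → (∀ {y} → P y → Q y) → (∀ {y} → Q y → P y) → IsMin G P x → IsMin G Q x
  IsMin-cong P⇒Q Q⇒P (px , x-min) = P⇒Q px , λ y qy → x-min y (Q⇒P qy)

  -- Exchanging a tree edge e for an edge f of its cut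

  module Exchange {T : Subset (m G)} (tree : IsSpanningTree G T) {e f : E}
                  (e∈T : e ∈ T) (f∈cut : Cut G T e f) (f≢e : f ≢ e) where

    T′ : Subset (m G)
    T′ = (T ∪ ⁅ f ⁆) - e

    T-acyclic : Acyclic T
    T-acyclic = proj₂ tree

    e∈cut : Cut G T e e
    e∈cut = tree-edge-cut T-acyclic e∈T

    f∉T : f ∉ T
    f∉T f∈T = f∈cut (edge-linked (x∈p-y⁺ f∈T f≢e))

    ∈T′⁺ : ∀ {z} → z ∈ T ⊎ z ≡ f → z ≢ e → z ∈ T′
    ∈T′⁺ z∈T∪f = x∈p-y⁺ (x∈p∪⁅y⁆⁺ z∈T∪f)

    ∈T′⁻ : ∀ {z} → z ∈ T′ → (z ∈ T ⊎ z ≡ f) × z ≢ e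
    ∈T′⁻ = Product.map₁ x∈p∪⁅y⁆⁻ ∘ x∈p-y⁻

    f∈T′ : f ∈ T′
    f∈T′ = ∈T′⁺ (inj₂ refl) f≢e

    e∉T′ : e ∉ T′
    e∉T′ e∈T′ = proj₂ (∈T′⁻ e∈T′) refl

    T-e⊆T′ : T - e ⊆ T′
    T-e⊆T′ = Product.uncurry (∈T′⁺ ∘ inj₁) ∘ x∈p-y⁻

    T′-f⊆T-e : T′ - f ⊆ T - e
    T′-f⊆T-e z∈T′-f with x∈p-y⁻ z∈T′-f
    ... | z∈T′ , z≢f with ∈T′⁻ z∈T′
    ...   | inj₁ z∈T , z≢e = x∈p-y⁺ z∈T z≢e
    ...   | inj₂ z≡f , _   = ⊥-elim (z≢f z≡f)

    T-e⊆T′-f : T - e ⊆ T′ - f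
    T-e⊆T′-f z∈T-e = x∈p-y⁺ (T-e⊆T′ z∈T-e) λ { refl → f∉T (p-y⊆p z∈T-e) }

    ∈T′⇒∈T : ∀ {z} → z ∈ T′ → z ≢ f → z ∈ T
    ∈T′⇒∈T z∈T′ z≢f = p-y⊆p (T′-f⊆T-e (x∈p-y⁺ z∈T′ z≢f))

    cut′-f≡cut-e : Cut G T′ f ≡ Cut G T e
    cut′-f≡cut-e = cong (λ S y → ¬ Linked S y) (⊆-antisym T′-f⊆T-e T-e⊆T′-f)

    e-linked : Linked T′ e
    e-linked = reach-exchange T-e⊆T′ f∈T′ (proj₁ tree _ _) f∈cut

    T′-connected : ∀ u v → Reach G T′ u v
    T′-connected u v = reach-reroute via (proj₁ tree u v)
      where
      via : ∀ {z} → z ∈ T → z ∈ T′ ⊎ Linked T′ z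
      via z∈T = Sum.map T-e⊆T′ (λ { refl → e-linked }) (x∈p⊎x≡y e z∈T)

    T′-acyclic : Acyclic T′
    T′-acyclic (C , cycle , C⊆T′) with f ∈? C
    ... | yes f∈C = f∈cut (cycle-closes cycle f∈C λ {z} z∈C z≢f → edge-linked (T′-f⊆T-e (x∈p-y⁺ (C⊆T′ z z∈C) z≢f)))
    ... | no  f∉C = T-acyclic (C , cycle , λ z z∈C → ∈T′⇒∈T (C⊆T′ z z∈C) λ { refl → f∉C z∈C })

    T′-spanning : IsSpanningTree G T′
    T′-spanning = T′-connected , T′-acyclic

    f-on-cycle : Cyc G T′ e f
    f-on-cycle with cycle-through e∉T′ e-linked
    ... | C , cycle , C⊆T′∪e , e∈C with f ∈? C
    ...   | yes f∈C = C , cycle , C⊆T′∪e , e∈C , f∈C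
    ...   | no  f∉C = ⊥-elim (T-acyclic (C , cycle , λ z z∈C → C⊆T z (C⊆T′∪e z z∈C) z∈C))
      where
      C⊆T : ∀ z → z ∈ T′ ⊎ z ≡ e → z ∈ C → z ∈ T
      C⊆T z (inj₁ z∈T′) z∈C = ∈T′⇒∈T z∈T′ λ { refl → f∉C z∈C }
      C⊆T z (inj₂ refl) _   = e∈T

    restores : (T′ ∪ ⁅ e ⁆) - f ≡ T
    restores = ⊆-antisym ⊆T ⊇T
      where
      ⊆T : (T′ ∪ ⁅ e ⁆) - f ⊆ T
      ⊆T z∈ with x∈p-y⁻ z∈
      ... | z∈T′∪e , z≢f with x∈p∪⁅y⁆⁻ z∈T′∪e
      ...   | inj₁ z∈T′ = ∈T′⇒∈T z∈T′ z≢f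
      ...   | inj₂ refl = e∈T
      ⊇T : T ⊆ (T′ ∪ ⁅ e ⁆) - f
      ⊇T z∈T = x∈p-y⁺ (x∈p∪⁅y⁆⁺ (Sum.map₁ T-e⊆T′ (x∈p⊎x≡y e z∈T))) λ { refl → f∉T z∈T }

    module _ (f-min : ∀ y → Cut G T e y → f ≤ᶠ y) where

      f-active′ : InternallyActive G T′ f
      f-active′ = f∈T′ , subst (λ P → IsMin G P f) (sym cut′-f≡cut-e) (f∈cut , f-min)

      T′-NBC : IsNBC G T → IsNBC G T′
      T′-NBC nbc (C , c , cycle , (c∈C , c-min) , C-c⊆T′) with f ∈? C | f Fin.≟ c
      ... | yes f∈C | no f≢c = f≢c (Fin.≤-antisym (f-min c c∈cut) (c-min f f∈C))
        where
        -- f is the only edge of C - c outside T - e, so C would link f's ends in T - e.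
        c∈cut : Cut G T e c
        c∈cut c-linked = f∈cut (cycle-closes cycle f∈C others)
          where
          others : ∀ {z} → z ∈ C → z ≢ f → Linked (T - e) z
          others {z} z∈C z≢f with z Fin.≟ c
          ... | yes refl = c-linked
          ... | no  z≢c  = edge-linked (T′-f⊆T-e (x∈p-y⁺ (C-c⊆T′ z z∈C z≢c) z≢f))
      ... | yes _   | yes refl = nbc (C , f , cycle , (c∈C , c-min) , λ z z∈C z≢f → ∈T′⇒∈T (C-c⊆T′ z z∈C z≢f) z≢f)
      ... | no  f∉C | _        = nbc (C , c , cycle , (c∈C , c-min) ,
                                    λ z z∈C z≢c → ∈T′⇒∈T (C-c⊆T′ z z∈C z≢c) λ { refl → f∉C z∈C })

      module _ (e-min : ∀ x → InternallyInactive G T x → e ≤ᶠ x) where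

        module _ {x : E} (x∈T : x ∈ T) (x≢e : x ≢ e) where

          private
            x∈T′ : x ∈ T′
            x∈T′ = ∈T′⁺ (inj₁ x∈T) x≢e
            e∈T-x : e ∈ T - x
            e∈T-x = x∈p-y⁺ e∈T (x≢e ∘ sym)
            f∈T′-x : f ∈ T′ - x
            f∈T′-x = x∈p-y⁺ f∈T′ λ { refl → f∉T x∈T }
            T-x-e⊆T′-x : (T - x) - e ⊆ T′ - x
            T-x-e⊆T′-x = -y-mono T-e⊆T′ ∘ -swap
            T′-x-f⊆T-x : (T′ - x) - f ⊆ T - x
            T′-x-f⊆T-x = -y-mono (p-y⊆p ∘ T′-f⊆T-e) ∘ -swap

          reach-T⇒T′ : Linked (T - x) f → ∀ {u v} → Reach G (T - x) u v → Reach G (T′ - x) u v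
          reach-T⇒T′ f-linked = reach-reroute via
            where
            via : ∀ {z} → z ∈ T - x → z ∈ T′ - x ⊎ Linked (T′ - x) z
            via z∈T-x with x∈p⊎x≡y e z∈T-x
            ... | inj₁ z∈T-x-e = inj₁ (T-x-e⊆T′-x z∈T-x-e)
            ... | inj₂ refl    = inj₂ (reach-exchange T-x-e⊆T′-x f∈T′-x f-linked
                                         (f∈cut ∘ reach-mono (-y-mono p-y⊆p)))

          reach-T′⇒T : Linked (T - x) f → ∀ {u v} → Reach G (T′ - x) u v → Reach G (T - x) u v
          reach-T′⇒T f-linked = reach-reroute via
            where
            via : ∀ {z} → z ∈ T′ - x → z ∈ T - x ⊎ Linked (T - x) z
            via z∈T′-x with x∈p-y⁻ z∈T′-x
            ... | z∈T′ , z≢x = Sum.map (λ z∈T → x∈p-y⁺ z∈T z≢x) (λ { refl → f-linked }) (proj₁ (∈T′⁻ z∈T′))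

          e∈cut′ : Cut G T x f → Cut G T′ x e
          e∈cut′ f∈cut-x e-linked′ = f∈cut-x
            (reach-exchange T′-x-f⊆T-x e∈T-x e-linked′ (e∈cut ∘ reach-mono (T′-f⊆T-e ∘ -y-mono p-y⊆p)))

          active-preserved : Cut G T x f → IsMin G (Cut G T x) x → IsMin G (Cut G T′ x) x
          active-preserved f∈cut-x (_ , x-min) = tree-edge-cut T′-acyclic x∈T′ , bound
            where
            bound : ∀ y → Cut G T′ x y → x ≤ᶠ y
            bound y y∈cut′ with reach? (T - x) (src y) (tgt y) | reach? (T - e) (src y) (tgt y)
            ... | no  y∈cut-x | _           = x-min y y∈cut-x
            ... | yes _       | no y∈cut-e  = Fin.≤-trans (x-min f f∈cut-x) (f-min y y∈cut-e)
            ... | yes r-x     | yes r-e     =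
              ⊥-elim (y∈cut′ (reach-mono T-x-e⊆T′-x (reach-avoiding e∈cut p-y⊆p r-x r-e)))

          active-reflected : Cut G T x f → IsMin G (Cut G T′ x) x → IsMin G (Cut G T x) x
          active-reflected f∈cut-x (_ , x-min′) =
            below-least-inactive T-acyclic e-min x∈T (x-min′ e (e∈cut′ f∈cut-x)) x≢e

          active⇔active′ : IsMin G (Cut G T x) x ⇔ IsMin G (Cut G T′ x) x
          active⇔active′ with reach? (T - x) (src f) (tgt f)
          ... | yes f-linked = mk⇔
            (IsMin-cong (_∘ reach-T′⇒T f-linked) (_∘ reach-T⇒T′ f-linked))
            (IsMin-cong (_∘ reach-T⇒T′ f-linked) (_∘ reach-T′⇒T f-linked))
          ... | no f∈cut-x = mk⇔ (active-preserved f∈cut-x) (active-reflected f∈cut-x)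

        inactive′⇔ : ∀ y → InternallyInactive G T′ y ⇔ (InternallyInactive G T y × y ≢ e)
        inactive′⇔ y = mk⇔ fwd bwd
          where
          fwd : InternallyInactive G T′ y → InternallyInactive G T y × y ≢ e
          fwd (y∈T′ , ¬min′) with ∈T′⁻ y∈T′
          ... | inj₂ refl , _   = ⊥-elim (¬min′ (proj₂ f-active′))
          ... | inj₁ y∈T , y≢e = (y∈T , ¬min′ ∘ to (active⇔active′ y∈T y≢e)) , y≢e
          bwd : InternallyInactive G T y × y ≢ e → InternallyInactive G T′ y
          bwd ((y∈T , ¬min) , y≢e) = ∈T′⁺ (inj₁ y∈T) y≢e , ¬min ∘ from (active⇔active′ y∈T y≢e)

        f-max : IsMax G (λ x → InternallyActive G T′ x × Cyc G T′ e x) f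
        f-max = (f-active′ , f-on-cycle) , bound
          where
          bound : ∀ x → InternallyActive G T′ x × Cyc G T′ e x → x ≤ᶠ f
          bound x ((x∈T′ , _ , x-min′) , C , cycle , C⊆T′∪e , _ , x∈C) with x Fin.≟ f
          ... | yes refl = Fin.≤-refl
          ... | no  x≢f  = proj₂ x-min f (cycle-edge-cut T-acyclic cycle C⊆T∪f x∈C x∈T x≢f)
            where
            x∈T : x ∈ T
            x∈T = ∈T′⇒∈T x∈T′ x≢f
            x≢e : x ≢ e
            x≢e = proj₂ (∈T′⁻ x∈T′)
            x-min : IsMin G (Cut G T x) x
            x-min = below-least-inactive T-acyclic e-min x∈T
                      (x-min′ e (cycle-edge-cut T′-acyclic cycle C⊆T′∪e x∈C x∈T′ x≢e)) x≢e
            C⊆T∪f : ∀ z → z ∈ C → z ∈ T ⊎ z ≡ f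
            C⊆T∪f z z∈C = [ proj₁ ∘ ∈T′⁻ , (λ { refl → inj₁ e∈T }) ]′ (C⊆T′∪e z z∈C)

lemma3p19 : (G : SimpleGraph) → Connected G →
    (T : Subset (m G)) → IsSpanningTree G T → IsNBC G T →
    (k : ℕ) → HasSize (InternallyInactive G T) (suc k) →
    Σ (Fin (m G)) λ e → Σ (Fin (m G)) λ f →
      InternallyInactive G T e × IsMin G (Cut G T e) f ×
      IsSpanningTree G ((T ∪ ⁅ f ⁆) ─ ⁅ e ⁆) × IsNBC G ((T ∪ ⁅ f ⁆) ─ ⁅ e ⁆) ×
      HasSize (InternallyInactive G ((T ∪ ⁅ f ⁆) ─ ⁅ e ⁆)) k ×
      Σ (Fin (m G)) λ g →
        IsMax G (λ x → InternallyActive G ((T ∪ ⁅ f ⁆) ─ ⁅ e ⁆) x × Cyc G ((T ∪ ⁅ f ⁆) ─ ⁅ e ⁆) e x) g ×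
        (((T ∪ ⁅ f ⁆) ─ ⁅ e ⁆) ∪ ⁅ e ⁆) ─ ⁅ g ⁆ ≡ T
lemma3p19 G _ T tree nbc k size
  with least (HasSize⇒Decidable size) (HasSize-suc⇒nonempty size)
... | e , e-inactive@(e∈T , e-not-active) , e-min
  with least (Properties.cut? G T e) (e , Properties.tree-edge-cut G (proj₂ tree) e∈T)
... | f , f-least@(f∈cut , f-min) =
  e , f , e-inactive , f-least , T′-spanning , T′-NBC f-min nbc ,
  HasSize-remove size e-inactive (inactive′⇔ f-min e-min) ,
  f , f-max f-min e-min , restores
  where
  open Properties G
  f≢e : f ≢ e
  f≢e refl = e-not-active f-least
  open Exchange tree e∈T f∈cut f≢e
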